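{- Let $l\ge 3$ and $n\ge l$ be integers and let $r_l\in\{0,1,2\}$ with $l\equiv r_l\pmod 3$. Then $$pr(K_n,P_l)\ge\max\Big\{\binom{l-3}{2}+1,\ \Big(\Big\lfloor\frac{l}{3}\Big\rfloor-1\Big)n-\binom{\lfloor l/3\rfloor}{2}+1+r_l\Big\}.$$
   Context: $P_l$ denotes the path on $l$ vertices. A subgraph of an edge-colored graph is properly colored if any two adjacent edges receive different colors. $pr(K_n,G)$ denotes the maximum number of colors in an (arbitrary) edge-coloring of the complete graph $K_n$ that contains no properly colored copy of $G$. -}

module Defs where

open import Data.Nat using (ℕ; suc)
open import Data.Fin using (Fin; toℕ)
open import Data.Product using (Σ; ∃; _×_)
open import Relation.Binary.PropositionalEquality using (_≡_; _≢_)
open import Function.Definitions using (Injective)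

-- An edge-colouring of K_n with colour set Fin k: a symmetric function on
-- pairs of vertices (values on the diagonal u = u are irrelevant).
record EdgeColouring (n k : ℕ) : Set where
  field
    col  : Fin n → Fin n → Fin k
    sym  : ∀ u v → col u v ≡ col v u

UsesAllColours : ∀ {n k} → EdgeColouring n k → Set
UsesAllColours {n} {k} c =
  ∀ (a : Fin k) → ∃ λ (u : Fin n) → ∃ λ (v : Fin n) → u ≢ v × EdgeColouring.col c u v ≡ a

-- A copy of P_l in K_n: an injective sequence of l vertices v_0,...,v_{l-1};
-- its edges are {v_i, v_{i+1}}.
ProperlyColouredPath : ∀ {n k} → EdgeColouring n k → (l : ℕ) → (Fin l → Fin n) → Set
ProperlyColouredPath c l v =
  Injective _≡_ _≡_ v ×
  (∀ (i j m : Fin l) → toℕ j ≡ suc (toℕ i) → toℕ m ≡ suc (toℕ j) →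
     EdgeColouring.col c (v i) (v j) ≢ EdgeColouring.col c (v j) (v m))

NoPCPath : ∀ {n k} → EdgeColouring n k → ℕ → Set
NoPCPath {n} c l = ∀ (v : Fin l → Fin n) → ProperlyColouredPath c l v → Data.Empty.⊥
  where import Data.Empty

-- pr(K_n, P_l) ≥ m  ⇔  some colouring of K_n using exactly k ≥ m colours
-- contains no properly coloured P_l.
PrAtLeast : ℕ → ℕ → ℕ → Set
PrAtLeast n l m =
  ∃ λ (k : ℕ) → m Data.Nat.≤ k × Σ (EdgeColouring n k) (λ c → UsesAllColours c × NoPCPath c l)
  where import Data.Nat

module Submission where

-- Each term is witnessed by an explicit colouring of K_n on the vertices 0 … n-1:
--   * RainbowClique: a rainbow clique on l - 3 vertices, every other edge in one
--     further colour;
--   * Stars: q - 1 star vertices all of whose edges get distinct colours, the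
--     remaining vertices coloured with r + 1 colours by how an edge meets the
--     (at most two) special vertices q-1, q.
-- Both lack a properly coloured P_l by one weight argument (no-proper-path):
-- give vertices letters with weights so that the letters along a properly
-- coloured path form an allowed word; a potential function (length-bound)
-- shows that an allowed word is at most two letters longer than its weight,
-- and by injectivity the weight of a path is at most the total weight of all
-- vertices (∑-injective-≤), which is at most l - 3.  The file develops finite sums,
-- the potential lemma and colourings given by tables of numbers, then the two
-- constructions; the theorem is the maximum of the two bounds.

open import Defs
open import Data.Nat using (ℕ; zero; suc; _+_; _*_; _∸_; _⊔_; _⊓_; _≤_; _<_; z≤n; s≤s; s≤s⁻¹; _<ᵇ_; _≤ᵇ_; _≡ᵇ_; _<?_; _≟_)
open import Data.Nat.Properties
open import Data.Nat.Combinatorics using (_C_; nCk+nC[k+1]≡[n+1]C[k+1]; nC1≡n)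
open import Data.Nat.DivMod using (_/_; _%_; m%n<n; m≡m%n+[m/n]*n)
open import Data.Nat.Tactic.RingSolver using (solve-∀)
open import Data.Fin using (Fin; toℕ; fromℕ<)
open import Data.Fin.Properties using (toℕ-fromℕ<; fromℕ<-toℕ; toℕ<n; toℕ-injective; fromℕ<-cong)
open import Data.Bool using (Bool; true; false; T; not; _∨_; _∧_; if_then_else_)
open import Data.Unit using (tt)
open import Data.Empty using (⊥-elim)
open import Data.Sum using (inj₁; inj₂)
open import Data.Product using (∃; ∃₂; _×_; _,_)
open import Relation.Nullary using (Dec; yes; no)
open import Relation.Binary.PropositionalEquality
open import Function using (_∘_)
open import Function.Definitions using (Injective)

<ᵇ-< : ∀ {x a} → x < a → (x <ᵇ a) ≡ true
<ᵇ-< {x} {a} x<a with x <ᵇ a | <⇒<ᵇ x<a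
... | true | _ = refl

<ᵇ-≥ : ∀ {x a} → a ≤ x → (x <ᵇ a) ≡ false
<ᵇ-≥ {x} {a} a≤x with x <ᵇ a | <ᵇ⇒< x a
... | false | _   = refl
... | true  | x<a = ⊥-elim (<⇒≱ (x<a tt) a≤x)

<ᵇ-false : ∀ x a → (x <ᵇ a) ≡ false → a ≤ x
<ᵇ-false x a eq = ≮⇒≥ (λ x<a → subst T eq (<⇒<ᵇ x<a))

+-<-∸ : ∀ m d n → d < n ∸ m → m + d < n
+-<-∸ m d n d<n∸m = begin-strict
  m + d       <⟨ +-monoʳ-< m d<n∸m ⟩
  m + (n ∸ m) ≡⟨ m+[n∸m]≡n {m} {n} (<⇒≤ (m∸n≢0⇒n<m (m<n⇒n≢0 d<n∸m))) ⟩
  n           ∎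
  where open ≤-Reasoning

-- The edge {u, u + 1 + d} is the d-th edge leaving u upwards.
suc+∸ : ∀ u d → suc u + d ∸ u ∸ 1 ≡ d
suc+∸ zero    d = refl
suc+∸ (suc u) d = suc+∸ u d

∑ : ℕ → (ℕ → ℕ) → ℕ
∑ zero    f = 0
∑ (suc L) f = f 0 + ∑ L (λ i → f (suc i))

∑-snoc : ∀ L f → ∑ (suc L) f ≡ ∑ L f + f L
∑-snoc zero    f = +-identityʳ (f 0)
∑-snoc (suc L) f = begin
  f 0 + ∑ (suc L) (λ i → f (suc i))    ≡⟨ cong (f 0 +_) (∑-snoc L (λ i → f (suc i))) ⟩
  f 0 + (∑ L (λ i → f (suc i)) + f (suc L)) ≡⟨ sym (+-assoc (f 0) _ _) ⟩
  f 0 + ∑ L (λ i → f (suc i)) + f (suc L) ∎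
  where open ≡-Reasoning

∑-mono : ∀ L (f g : ℕ → ℕ) → (∀ i → i < L → f i ≤ g i) → ∑ L f ≤ ∑ L g
∑-mono zero    f g f≤g = z≤n
∑-mono (suc L) f g f≤g =
  +-mono-≤ (f≤g 0 (s≤s z≤n)) (∑-mono L _ _ (λ i i<L → f≤g (suc i) (s≤s i<L)))

∑-+ : ∀ L (f g : ℕ → ℕ) → ∑ L (λ i → f i + g i) ≡ ∑ L f + ∑ L g
∑-+ zero    f g = refl
∑-+ (suc L) f g = begin
  f 0 + g 0 + ∑ L (λ i → f (suc i) + g (suc i))
    ≡⟨ cong (f 0 + g 0 +_) (∑-+ L (λ i → f (suc i)) (λ i → g (suc i))) ⟩
  f 0 + g 0 + (∑ L (λ i → f (suc i)) + ∑ L (λ i → g (suc i)))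
    ≡⟨ interchange (f 0) (g 0) _ _ ⟩
  f 0 + ∑ L (λ i → f (suc i)) + (g 0 + ∑ L (λ i → g (suc i))) ∎
  where
  open ≡-Reasoning
  interchange : ∀ a b c d → a + b + (c + d) ≡ a + c + (b + d)
  interchange = solve-∀

∑-const : ∀ L c → ∑ L (λ _ → c) ≡ L * c
∑-const zero    c = refl
∑-const (suc L) c = cong (c +_) (∑-const L c)

∑-split : ∀ m k f → ∑ (m + k) f ≡ ∑ m f + ∑ k (λ i → f (m + i))
∑-split zero    k f = refl
∑-split (suc m) k f =
  trans (cong (f 0 +_) (∑-split m k (λ i → f (suc i)))) (sym (+-assoc (f 0) _ _))

-- The intervals [∑ u g, ∑ u g + g u) for u < B tile [0, ∑ B g): this is how
-- colours numbered by ∑ are traced back to the edge carrying them.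
locate : ∀ (g : ℕ → ℕ) B c → c < ∑ B g → ∃₂ λ u d → u < B × d < g u × c ≡ ∑ u g + d
locate g zero    c ()
locate g (suc B) c c<∑ with c <? ∑ B g
... | yes c<∑B = let u , d , u<B , d<g , c≡ = locate g B c c<∑B in u , d , m<n⇒m<1+n u<B , d<g , c≡
... | no  c≮∑B = B , c ∸ ∑ B g , n<1+n B , d<g , sym (m+[n∸m]≡n (≮⇒≥ c≮∑B))
  where
  d<g : c ∸ ∑ B g < g B
  d<g = +-cancelˡ-< (∑ B g) _ _ (begin-strict
    ∑ B g + (c ∸ ∑ B g) ≡⟨ m+[n∸m]≡n (≮⇒≥ c≮∑B) ⟩
    c                   <⟨ c<∑ ⟩
    ∑ (suc B) g         ≡⟨ ∑-snoc B g ⟩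
    ∑ B g + g B         ∎)
    where open ≤-Reasoning

-- Pairs u < w are numbered by ∑ w id + u; there are w C 2 pairs below w.
∑-id≡C2 : ∀ w → ∑ w (λ i → i) ≡ w C 2
∑-id≡C2 zero    = refl
∑-id≡C2 (suc w) = begin
  ∑ (suc w) (λ i → i) ≡⟨ ∑-snoc w (λ i → i) ⟩
  ∑ w (λ i → i) + w   ≡⟨ cong₂ _+_ (∑-id≡C2 w) (sym (nC1≡n w)) ⟩
  w C 2 + w C 1       ≡⟨ +-comm (w C 2) _ ⟩
  w C 1 + w C 2       ≡⟨ nCk+nC[k+1]≡[n+1]C[k+1] w 1 ⟩
  suc w C 2           ∎
  where open ≡-Reasoning

[_]·_ : ∀ {p} {P : Set p} → Dec P → ℕ → ℕ
[ yes _ ]· c = c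
[ no  _ ]· c = 0

InjectiveOn : ℕ → (ℕ → ℕ) → Set
InjectiveOn L g = ∀ i j → i < L → j < L → g i ≡ g j → i ≡ j

∑-misses : ∀ L (g : ℕ → ℕ) k c → (∀ i → i < L → g i ≢ k) → ∑ L (λ i → [ g i ≟ k ]· c) ≡ 0
∑-misses zero    g k c miss = refl
∑-misses (suc L) g k c miss with g 0 ≟ k
... | yes g0≡k = ⊥-elim (miss 0 (s≤s z≤n) g0≡k)
... | no  _    = ∑-misses L (λ i → g (suc i)) k c (λ i i<L → miss (suc i) (s≤s i<L))

-- An injective sequence takes a given value at most once.
∑-hits-≤ : ∀ L (g : ℕ → ℕ) k c → InjectiveOn L g → ∑ L (λ i → [ g i ≟ k ]· c) ≤ c
∑-hits-≤ zero    g k c inj = z≤n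
∑-hits-≤ (suc L) g k c inj with g 0 ≟ k
... | yes g0≡k = ≤-reflexive (trans (cong (c +_) (∑-misses L (λ i → g (suc i)) k c no-repeat)) (+-identityʳ c))
  where
  no-repeat : ∀ i → i < L → g (suc i) ≢ k
  no-repeat i i<L gi≡k = 0≢1+n (inj 0 (suc i) (s≤s z≤n) (s≤s i<L) (trans g0≡k (sym gi≡k)))
... | no  _    = ∑-hits-≤ L (λ i → g (suc i)) k c
  (λ i j i<L j<L e → suc-injective (inj (suc i) (suc j) (s≤s i<L) (s≤s j<L) e))

below-suc : ∀ N x (w : ℕ → ℕ) → [ x <? suc N ]· w x ≤ [ x <? N ]· w x + [ x ≟ N ]· w N
below-suc N x w with x <? suc N | x <? N | x ≟ N
... | yes _         | yes _   | _        = m≤m+n _ _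
... | yes _         | no  _   | yes refl = ≤-refl
... | yes (s≤s x≤N) | no  x≮N | no  x≢N  = ⊥-elim (x≮N (≤∧≢⇒< x≤N x≢N))
... | no  _         | _       | _        = z≤n

-- Summing w along an injective sequence, counting only values below N,
-- gives at most ∑ N w: each x < N is visited at most once.
∑-reindex-≤ : ∀ L (g w : ℕ → ℕ) → InjectiveOn L g → ∀ N → ∑ L (λ i → [ g i <? N ]· w (g i)) ≤ ∑ N w
∑-reindex-≤ L g w inj zero = ≤-reflexive (nothing-below-0 L g)
  where
  nothing-below-0 : ∀ L g → ∑ L (λ i → [ g i <? 0 ]· w (g i)) ≡ 0
  nothing-below-0 zero    g = refl
  nothing-below-0 (suc L) g = nothing-below-0 L (λ i → g (suc i))
∑-reindex-≤ L g w inj (suc N) = begin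
  ∑ L (λ i → [ g i <? suc N ]· w (g i))
    ≤⟨ ∑-mono L _ _ (λ i _ → below-suc N (g i) w) ⟩
  ∑ L (λ i → [ g i <? N ]· w (g i) + [ g i ≟ N ]· w N)
    ≡⟨ ∑-+ L _ _ ⟩
  ∑ L (λ i → [ g i <? N ]· w (g i)) + ∑ L (λ i → [ g i ≟ N ]· w N)
    ≤⟨ +-mono-≤ (∑-reindex-≤ L g w inj N) (∑-hits-≤ L g N (w N) inj) ⟩
  ∑ N w + w N
    ≡⟨ sym (∑-snoc N w) ⟩
  ∑ (suc N) w ∎
  where open ≤-Reasoning

∑-injective-≤ : ∀ L (g w : ℕ → ℕ) N → InjectiveOn L g → (∀ x → N ≤ x → w x ≡ 0) →
  ∑ L (λ i → w (g i)) ≤ ∑ N w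
∑-injective-≤ L g w N inj vanish =
  ≤-trans (∑-mono L _ _ (λ i _ → restrict (g i))) (∑-reindex-≤ L g w inj N)
  where
  restrict : ∀ x → w x ≤ [ x <? N ]· w x
  restrict x with x <? N
  ... | yes _   = ≤-refl
  ... | no  x≮N = ≤-reflexive (vanish x (≮⇒≥ x≮N))

record Potential (Ty : Set) : Set where
  field
    weight  : Ty → ℕ
    allowed : Ty → Ty → Ty → Bool
    K       : Ty → Ty → ℕ
    K-start : ∀ a b → K a b ≤ weight a + weight b
    K-step  : ∀ a b c → T (allowed a b c) → suc (K a b) ≤ weight a + K b c

module _ {Ty : Set} (P : Potential Ty) where
  open Potential P

  AllowedWord : ℕ → (ℕ → Ty) → Set
  AllowedWord L f = ∀ i → 2 + i < L → T (allowed (f i) (f (1 + i)) (f (2 + i)))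

  potential-bound : ∀ m f → AllowedWord (2 + m) f →
    2 + m + K (f 0) (f 1) ≤ ∑ (2 + m) (weight ∘ f) + 2
  potential-bound zero f _ = begin
    2 + K (f 0) (f 1)                ≤⟨ +-monoʳ-≤ 2 (K-start (f 0) (f 1)) ⟩
    2 + (weight (f 0) + weight (f 1)) ≡⟨ shuffle (weight (f 0)) (weight (f 1)) ⟩
    ∑ 2 (weight ∘ f) + 2             ∎
    where
    open ≤-Reasoning
    shuffle : ∀ a b → 2 + (a + b) ≡ a + (b + 0) + 2
    shuffle = solve-∀
  potential-bound (suc m) f allowed-f = begin
    3 + m + K (f 0) (f 1)                   ≡⟨ sym (+-suc (2 + m) _) ⟩
    2 + m + suc (K (f 0) (f 1))             ≤⟨ +-monoʳ-≤ (2 + m) (K-step (f 0) (f 1) (f 2) (allowed-f 0 (s≤s (s≤s (s≤s z≤n))))) ⟩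
    2 + m + (weight (f 0) + K (f 1) (f 2))  ≡⟨ swap (2 + m) (weight (f 0)) _ ⟩
    weight (f 0) + (2 + m + K (f 1) (f 2))  ≤⟨ +-monoʳ-≤ (weight (f 0)) (potential-bound m (f ∘ suc) (λ i → allowed-f (suc i) ∘ s≤s)) ⟩
    weight (f 0) + (∑ (2 + m) (weight ∘ f ∘ suc) + 2) ≡⟨ sym (+-assoc (weight (f 0)) _ 2) ⟩
    ∑ (3 + m) (weight ∘ f) + 2              ∎
    where
    open ≤-Reasoning
    swap : ∀ a b c → a + (b + c) ≡ b + (a + c)
    swap = solve-∀

  length-bound : ∀ L f → AllowedWord L f → L ≤ ∑ L (weight ∘ f) + 2
  length-bound zero          f _         = z≤n
  length-bound (suc zero)    f _         = ≤-trans (s≤s z≤n) (m≤n+m 2 _)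
  length-bound (suc (suc m)) f allowed-f = ≤-trans (m≤m+n _ _) (potential-bound m f allowed-f)

-- A sequence of l vertices of K_n, read as an ℕ-indexed sequence (0 beyond l).
vertexSeq : ∀ {l n} → (Fin l → Fin n) → ℕ → ℕ
vertexSeq {l} v i with i <? l
... | yes i<l = toℕ (v (fromℕ< i<l))
... | no  _   = 0

vertexSeq-eq : ∀ {l n} (v : Fin l → Fin n) i (i<l : i < l) → vertexSeq v i ≡ toℕ (v (fromℕ< i<l))
vertexSeq-eq {l} v i i<l with i <? l
... | yes i<l′ = cong (toℕ ∘ v) (fromℕ<-cong i i refl i<l′ i<l)
... | no  i≮l  = ⊥-elim (i≮l i<l)

vertexSeq-injective : ∀ {l n} (v : Fin l → Fin n) → Injective _≡_ _≡_ v → InjectiveOn l (vertexSeq v)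
vertexSeq-injective v inj i j i<l j<l eq = begin
  i                  ≡⟨ sym (toℕ-fromℕ< i<l) ⟩
  toℕ (fromℕ< i<l)   ≡⟨ cong toℕ (inj (toℕ-injective same-vertex)) ⟩
  toℕ (fromℕ< j<l)   ≡⟨ toℕ-fromℕ< j<l ⟩
  j                  ∎
  where
  open ≡-Reasoning
  same-vertex : toℕ (v (fromℕ< i<l)) ≡ toℕ (v (fromℕ< j<l))
  same-vertex = trans (sym (vertexSeq-eq v i i<l)) (trans eq (vertexSeq-eq v j j<l))

-- Reading a number as a colour in Fin (suc k); out-of-range numbers are sent
-- to colour 0, so any ℕ-valued table yields a genuine colouring.
toColour : ∀ {k} → ℕ → Fin (suc k)
toColour {k} c with c <? suc k
... | yes c<1+k = fromℕ< c<1+k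
... | no  _     = Fin.zero
  where import Data.Fin as Fin

toColour-toℕ : ∀ {k} (a : Fin (suc k)) → toColour (toℕ a) ≡ a
toColour-toℕ {k} a with toℕ a <? suc k
... | yes a<1+k = fromℕ<-toℕ a a<1+k
... | no  a≮1+k = ⊥-elim (a≮1+k (toℕ<n a))

module ColourTable (n k : ℕ) (c : ℕ → ℕ → ℕ) (c-sym : ∀ x y → c x y ≡ c y x) where

  colouring : EdgeColouring n (suc k)
  colouring = record
    { col = λ u w → toColour (c (toℕ u) (toℕ w))
    ; sym = λ u w → cong toColour (c-sym (toℕ u) (toℕ w)) }

  Used : Fin (suc k) → Set
  Used a = ∃₂ λ (u w : Fin n) → u ≢ w × EdgeColouring.col colouring u w ≡ a

  colour-used : (a : Fin (suc k)) → ∀ x y → x < n → y < n → x ≢ y → c x y ≡ toℕ a → Used a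
  colour-used a x y x<n y<n x≢y cxy≡a =
    fromℕ< x<n , fromℕ< y<n ,
    (λ u≡w → x≢y (trans (sym (toℕ-fromℕ< x<n)) (trans (cong toℕ u≡w) (toℕ-fromℕ< y<n)))) ,
    trans (cong toColour (trans (cong₂ c (toℕ-fromℕ< x<n) (toℕ-fromℕ< y<n)) cxy≡a)) (toColour-toℕ a)

  -- Label the vertices by τ; if every triple with a
  -- non-allowed label pattern has equally coloured edges xy and yz, then the
  -- labels along a properly coloured path form an allowed word, so by
  -- length-bound and injectivity the path has at most ∑ N weight + 2 vertices
  -- (where vertices from N on have weight 0).
  no-proper-path : {Ty : Set} (P : Potential Ty) (τ : ℕ → Ty) →
    (∀ x y z → Potential.allowed P (τ x) (τ y) (τ z) ≡ false → c x y ≡ c y z) →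
    ∀ N → (∀ x → N ≤ x → Potential.weight P (τ x) ≡ 0) →
    ∀ l → ∑ N (Potential.weight P ∘ τ) + 2 < l → NoPCPath colouring l
  no-proper-path P τ forbidden-monochromatic N weight-vanishes l short v (inj , proper) =
    <⇒≱ short (begin
      l                                 ≤⟨ length-bound P l (τ ∘ vs) allowed-word ⟩
      ∑ l (weight ∘ τ ∘ vs) + 2         ≤⟨ +-monoˡ-≤ 2 (∑-injective-≤ l vs (weight ∘ τ) N (vertexSeq-injective v inj) weight-vanishes) ⟩
      ∑ N (weight ∘ τ) + 2              ∎)
    where
    open Potential P
    open ≤-Reasoning
    vs : ℕ → ℕ
    vs = vertexSeq v

    allowed-word : AllowedWord P l (τ ∘ vs)
    allowed-word i 2+i<l with allowed (τ (vs i)) (τ (vs (1 + i))) (τ (vs (2 + i))) in eq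
    ... | true  = tt
    ... | false = proper (fromℕ< i<l) (fromℕ< 1+i<l) (fromℕ< 2+i<l)
        (trans (toℕ-fromℕ< 1+i<l) (cong suc (sym (toℕ-fromℕ< i<l))))
        (trans (toℕ-fromℕ< 2+i<l) (cong suc (sym (toℕ-fromℕ< 1+i<l))))
        (cong toColour same-colour)
      where
      1+i<l : 1 + i < l
      1+i<l = <-trans (n<1+n (suc i)) 2+i<l
      i<l : i < l
      i<l = <-trans (n<1+n i) 1+i<l
      same-colour : c (toℕ (v (fromℕ< i<l))) (toℕ (v (fromℕ< 1+i<l))) ≡ c (toℕ (v (fromℕ< 1+i<l))) (toℕ (v (fromℕ< 2+i<l)))
      same-colour
        rewrite sym (vertexSeq-eq v i i<l) | sym (vertexSeq-eq v (1 + i) 1+i<l) | sym (vertexSeq-eq v (2 + i) 2+i<l)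
        = forbidden-monochromatic _ _ _ eq

-- First construction: a rainbow clique on the vertices 0 … a-1, every other
-- edge in one extra colour.  A properly coloured path can only turn at clique
-- vertices, so it has at most a + 2 vertices; a C 2 + 1 colours are used.
module RainbowClique (n a : ℕ) (a+3≤n : a + 3 ≤ n) where

  E : ℕ
  E = ∑ a (λ i → i)

  c : ℕ → ℕ → ℕ
  c x y = if x ⊔ y <ᵇ a then ∑ (x ⊔ y) (λ i → i) + x ⊓ y else E

  c-sym : ∀ x y → c x y ≡ c y x
  c-sym x y rewrite ⊔-comm x y | ⊓-comm x y = refl

  c-clique : ∀ u w → u < w → w < a → c u w ≡ ∑ w (λ i → i) + u
  c-clique u w u<w w<a rewrite m≤n⇒m⊔n≡n (<⇒≤ u<w) | m≤n⇒m⊓n≡m (<⇒≤ u<w) | <ᵇ-< w<a = refl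

  c-outside : ∀ x y → a ≤ x ⊔ y → c x y ≡ E
  c-outside x y a≤x⊔y rewrite <ᵇ-≥ a≤x⊔y = refl

  -- Letters: whether a vertex lies in the clique; only clique vertices may
  -- sit in the middle of a properly coloured triple.
  inClique : ℕ → Bool
  inClique x = x <ᵇ a

  clique-weight : Bool → ℕ
  clique-weight b = if b then 1 else 0

  clique-potential : Potential Bool
  clique-potential = record
    { weight  = clique-weight
    ; allowed = λ _ b _ → b
    ; K       = λ b _ → clique-weight b
    ; K-start = λ b b′ → m≤m+n (clique-weight b) (clique-weight b′)
    ; K-step  = K-step }
    where
    K-step : ∀ b b′ b″ → T b′ → suc (clique-weight b) ≤ clique-weight b + clique-weight b′
    K-step b true _ _ = ≤-reflexive (+-comm 1 (clique-weight b))

  middle-outside : ∀ x y z → inClique y ≡ false → c x y ≡ c y z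
  middle-outside x y z y∉ = trans (c-outside x y (≤-trans a≤y (m≤n⊔m x y))) (sym (c-outside y z (≤-trans a≤y (m≤m⊔n y z))))
    where
    a≤y : a ≤ y
    a≤y = <ᵇ-false y a y∉

  outside-weightless : ∀ x → a ≤ x → clique-weight (inClique x) ≡ 0
  outside-weightless x a≤x = cong clique-weight (<ᵇ-≥ a≤x)

  total-weight : ∑ a (clique-weight ∘ inClique) ≤ a
  total-weight = begin
    ∑ a (clique-weight ∘ inClique) ≤⟨ ∑-mono a _ _ (λ i _ → at-most-1 (inClique i)) ⟩
    ∑ a (λ _ → 1)                  ≡⟨ ∑-const a 1 ⟩
    a * 1                          ≡⟨ *-identityʳ a ⟩
    a                              ∎
    where
    open ≤-Reasoning
    at-most-1 : ∀ b → clique-weight b ≤ 1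
    at-most-1 true  = ≤-refl
    at-most-1 false = z≤n

  open ColourTable n E c c-sym

  a<n : a < n
  a<n = ≤-trans (m<m+n a (s≤s z≤n)) a+3≤n

  1+a<n : suc a < n
  1+a<n = ≤-trans (≤-reflexive (+-comm 2 a)) (≤-trans (+-monoʳ-≤ a (n≤1+n 2)) a+3≤n)

  -- Colour ∑ w id + u sits on the clique edge {u, w}.
  clique-colour-used : ∀ col → toℕ col < E → Used col
  clique-colour-used col col<E with locate (λ i → i) a (toℕ col) col<E
  ... | w , u , w<a , u<w , col≡ =
    colour-used col u w (<-trans u<w w<n) w<n (<⇒≢ u<w) (trans (c-clique u w u<w w<a) (sym col≡))
    where
    w<n : w < n
    w<n = <-trans w<a a<n

  extra-colour-used : ∀ col → E ≤ toℕ col → Used col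
  extra-colour-used col E≤col =
    colour-used col a (suc a) a<n 1+a<n (<⇒≢ (n<1+n a))
      (trans (c-outside a (suc a) (m≤m⊔n a _)) (≤-antisym E≤col (s≤s⁻¹ (toℕ<n col))))

  all-colours-used : UsesAllColours colouring
  all-colours-used col with toℕ col <? E
  ... | yes col<E = clique-colour-used col col<E
  ... | no  col≮E = extra-colour-used col (≮⇒≥ col≮E)

  bound : PrAtLeast n (a + 3) (a C 2 + 1)
  bound =
    suc E , ≤-reflexive (trans (+-comm (a C 2) 1) (cong suc (sym (∑-id≡C2 a)))) ,
    colouring , all-colours-used ,
    no-proper-path clique-potential inClique middle-outside a outside-weightless (a + 3)
      (≤-<-trans (+-monoˡ-≤ 2 total-weight) (+-monoʳ-< a (n<1+n 2)))

-- Vertices 0 … s-1 are stars: each edge at a star gets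
-- its own colour.  The other vertices span a clique coloured E + κ, where κ
-- is 1 on edges at vertex s (label X, present if r ≥ 1), 2 on the remaining
-- edges at vertex s+1 (label Y, present if r = 2) and 0 elsewhere.
data Letter : Set where
  S X Y O : Letter

isS : Letter → Bool
isS S = true
isS _ = false

κ : Letter → Letter → ℕ
κ X _ = 1
κ _ X = 1
κ Y _ = 2
κ _ Y = 2
κ _ _ = 0

star-weight : Letter → ℕ
star-weight S = 3
star-weight X = 1
star-weight Y = 1
star-weight O = 0

star-allowed : Letter → Letter → Letter → Bool
star-allowed a b c = isS a ∨ isS b ∨ isS c ∨ not (κ a b ≡ᵇ κ b c)

-- The potential, found by search and certified by exhaustive evaluation.
star-K : Letter → Letter → ℕ
star-K S S = 4
star-K S X = 2
star-K S Y = 2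
star-K S O = 2
star-K X S = 2
star-K X X = 2
star-K X Y = 0
star-K X O = 0
star-K Y S = 2
star-K Y X = 2
star-K Y Y = 2
star-K Y O = 0
star-K O S = 1
star-K O X = 1
star-K O Y = 1
star-K O O = 0

every : (Letter → Bool) → Bool
every p = p S ∧ (p X ∧ (p Y ∧ p O))

∧-split : ∀ x {y} → T (x ∧ y) → T x × T y
∧-split true t = tt , t

every-sound : ∀ p → T (every p) → ∀ a → T (p a)
every-sound p h a with ∧-split (p S) h
... | pS , h′ with ∧-split (p X) h′
... | pX , h″ with ∧-split (p Y) h″
... | pY , pO with a
... | S = pS
... | X = pX
... | Y = pY
... | O = pO

every² : ∀ (p : Letter → Letter → Bool) → T (every λ a → every (p a)) → ∀ a b → T (p a b)
every² p h a = every-sound (p a) (every-sound (λ a → every (p a)) h a)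

every³ : ∀ (p : Letter → Letter → Letter → Bool) → T (every λ a → every λ b → every (p a b)) →
  ∀ a b c → T (p a b c)
every³ p h a b = every-sound (p a b) (every² (λ a b → every (p a b)) h a b)

κ-sym : ∀ a b → κ a b ≡ κ b a
κ-sym a b = ≡ᵇ⇒≡ _ _ (every² (λ a b → κ a b ≡ᵇ κ b a) tt a b)

star-potential : Potential Letter
star-potential = record
  { weight  = star-weight
  ; allowed = star-allowed
  ; K       = star-K
  ; K-start = λ a b → ≤ᵇ⇒≤ _ _ (every² (λ a b → star-K a b ≤ᵇ star-weight a + star-weight b) tt a b)
  ; K-step  = K-step }
  where
  K-step : ∀ a b c → T (star-allowed a b c) → suc (star-K a b) ≤ star-weight a + star-K b c
  K-step a b c allowed-abc = ≤ᵇ⇒≤ _ _ (implied (star-allowed a b c) checked allowed-abc)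
    where
    implied : ∀ x {y} → T (not x ∨ y) → T x → T y
    implied true t _ = t
    checked : T (not (star-allowed a b c) ∨ (suc (star-K a b) ≤ᵇ star-weight a + star-K b c))
    checked = every³ (λ a b c → not (star-allowed a b c) ∨ (suc (star-K a b) ≤ᵇ star-weight a + star-K b c)) tt a b c

forbidden-shape : ∀ a b c → star-allowed a b c ≡ false →
  isS a ≡ false × isS b ≡ false × isS c ≡ false × κ a b ≡ κ b c
forbidden-shape a b c forbidden with isS a | isS b | isS c | κ a b ≡ᵇ κ b c in same
forbidden-shape a b c () | true  | _     | _     | _
forbidden-shape a b c () | false | true  | _     | _
forbidden-shape a b c () | false | false | true  | _
forbidden-shape a b c () | false | false | false | false
... | false | false | false | true = refl , refl , refl , ≡ᵇ⇒≡ _ _ (subst T (sym same) tt)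

-- Label of the non-star vertex s + d when l ≡ r (mod 3): s is X if r ≥ 1,
-- s + 1 is Y if r = 2, all others are O.
highLetter : ℕ → ℕ → Letter
highLetter (suc r)       zero       = X
highLetter (suc (suc r)) (suc zero) = Y
highLetter _             _          = O

highLetter-weightless : ∀ r d → 2 ≤ d → star-weight (highLetter r d) ≡ 0
highLetter-weightless zero          d             _ = refl
highLetter-weightless (suc zero)    (suc (suc d)) _ = refl
highLetter-weightless (suc (suc r)) (suc (suc d)) _ = refl
highLetter-weightless (suc r)       (suc zero)    (s≤s ())

highLetter-weight : ∀ r → r < 3 → star-weight (highLetter r 0) + star-weight (highLetter r 1) ≤ r
highLetter-weight 0 _ = ≤-refl
highLetter-weight 1 _ = ≤-refl
highLetter-weight 2 _ = ≤-refl
highLetter-weight (suc (suc (suc r))) (s≤s (s≤s (s≤s ())))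

offset-realised : ∀ r j → r < 3 → j ≤ r → ∃ λ d → d < suc r × κ (highLetter r d) (highLetter r (suc r)) ≡ j
offset-realised 0 0 _ _ = 0 , s≤s z≤n , refl
offset-realised 1 0 _ _ = 1 , s≤s (s≤s z≤n) , refl
offset-realised 1 1 _ _ = 0 , s≤s z≤n , refl
offset-realised 2 0 _ _ = 2 , s≤s (s≤s (s≤s z≤n)) , refl
offset-realised 2 1 _ _ = 0 , s≤s z≤n , refl
offset-realised 2 2 _ _ = 1 , s≤s (s≤s z≤n) , refl
offset-realised 1 (suc (suc j)) _ (s≤s ())
offset-realised 2 (suc (suc (suc j))) _ (s≤s (s≤s ()))
offset-realised (suc (suc (suc r))) j (s≤s (s≤s (s≤s ()))) _

-- Along a path, stars weigh 3
-- and the special vertices s, s + 1 weigh r in total, so its weight is at most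
-- 3s + r = l - 3; E + r + 1 colours are used, with E ≥ s·n - C(s+1, 2).
module Stars (n s r : ℕ) (r<3 : r < 3) (l≤n : r + suc s * 3 ≤ n) where

  τ : ℕ → Letter
  τ x = if x <ᵇ s then S else highLetter r (x ∸ s)

  τ-star : ∀ {x} → x < s → τ x ≡ S
  τ-star x<s rewrite <ᵇ-< x<s = refl

  τ-high : ∀ {x} → s ≤ x → τ x ≡ highLetter r (x ∸ s)
  τ-high s≤x rewrite <ᵇ-≥ s≤x = refl

  τ-shift : ∀ d → τ (s + d) ≡ highLetter r d
  τ-shift d = trans (τ-high (m≤m+n s d)) (cong (highLetter r) (m+n∸m≡n s d))

  non-star : ∀ y → isS (τ y) ≡ false → s ≤ y
  non-star y not-star with y <? s
  ... | yes y<s = ⊥-elim (true≢false (subst (λ t → isS t ≡ false) (τ-star y<s) not-star))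
    where
    true≢false : true ≢ false
    true≢false ()
  ... | no  y≮s = ≮⇒≥ y≮s

  -- Star edges {u, w} (u < w, u < s) are numbered block by block: block u
  -- holds the n - 1 - u edges from u to larger vertices.
  block : ℕ → ℕ
  block u = n ∸ suc u

  E : ℕ
  E = ∑ s block

  c : ℕ → ℕ → ℕ
  c x y = if x ⊓ y <ᵇ s then ∑ (x ⊓ y) block + (x ⊔ y ∸ x ⊓ y ∸ 1) else E + κ (τ x) (τ y)

  c-sym : ∀ x y → c x y ≡ c y x
  c-sym x y rewrite ⊓-comm x y | ⊔-comm x y | κ-sym (τ x) (τ y) = refl

  c-star : ∀ u w → u < w → u < s → c u w ≡ ∑ u block + (w ∸ u ∸ 1)
  c-star u w u<w u<s rewrite m≤n⇒m⊓n≡m (<⇒≤ u<w) | m≤n⇒m⊔n≡n (<⇒≤ u<w) | <ᵇ-< u<s = refl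

  c-high : ∀ x y → s ≤ x → s ≤ y → c x y ≡ E + κ (τ x) (τ y)
  c-high x y s≤x s≤y rewrite <ᵇ-≥ (⊓-glb s≤x s≤y) = refl

  forbidden-monochromatic : ∀ x y z → star-allowed (τ x) (τ y) (τ z) ≡ false → c x y ≡ c y z
  forbidden-monochromatic x y z forbidden with forbidden-shape (τ x) (τ y) (τ z) forbidden
  ... | x∉ , y∉ , z∉ , same-offset = begin
    c x y                ≡⟨ c-high x y (non-star x x∉) (non-star y y∉) ⟩
    E + κ (τ x) (τ y)    ≡⟨ cong (E +_) same-offset ⟩
    E + κ (τ y) (τ z)    ≡⟨ sym (c-high y z (non-star y y∉) (non-star z z∉)) ⟩
    c y z                ∎
    where open ≡-Reasoning

  weightless : ∀ x → s + 2 ≤ x → star-weight (τ x) ≡ 0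
  weightless x s+2≤x = begin
    star-weight (τ x)                ≡⟨ cong star-weight (τ-high (≤-trans (m≤m+n s 2) s+2≤x)) ⟩
    star-weight (highLetter r (x ∸ s)) ≡⟨ highLetter-weightless r (x ∸ s) (subst (_≤ x ∸ s) (m+n∸m≡n s 2) (∸-monoˡ-≤ s s+2≤x)) ⟩
    0                                ∎
    where open ≡-Reasoning

  total-weight : ∑ (s + 2) (star-weight ∘ τ) ≤ s * 3 + r
  total-weight = begin
    ∑ (s + 2) (star-weight ∘ τ)
      ≡⟨ ∑-split s 2 (star-weight ∘ τ) ⟩
    ∑ s (star-weight ∘ τ) + (star-weight (τ (s + 0)) + (star-weight (τ (s + 1)) + 0))
      ≡⟨ cong (∑ s (star-weight ∘ τ) +_) (cong₂ _+_ (cong star-weight (τ-shift 0)) (cong (_+ 0) (cong star-weight (τ-shift 1)))) ⟩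
    ∑ s (star-weight ∘ τ) + (star-weight (highLetter r 0) + (star-weight (highLetter r 1) + 0))
      ≤⟨ +-mono-≤ (∑-mono s _ _ (λ i i<s → ≤-reflexive (cong star-weight (τ-star i<s))))
                  (≤-trans (≤-reflexive (cong (star-weight (highLetter r 0) +_) (+-identityʳ _))) (highLetter-weight r r<3)) ⟩
    ∑ s (λ _ → 3) + r
      ≡⟨ cong (_+ r) (∑-const s 3) ⟩
    s * 3 + r ∎
    where open ≤-Reasoning

  star-edges : ∀ u → u * n ≤ ∑ u block + suc u C 2
  star-edges zero    = z≤n
  star-edges (suc u) = begin
    n + u * n                                   ≤⟨ +-monoʳ-≤ n (star-edges u) ⟩
    n + (∑ u block + suc u C 2)                 ≤⟨ +-monoˡ-≤ _ (m≤n+m∸n n (suc u)) ⟩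
    suc u + block u + (∑ u block + suc u C 2)   ≡⟨ regroup (suc u) (block u) (∑ u block) (suc u C 2) ⟩
    ∑ u block + block u + (suc u + suc u C 2)   ≡⟨ cong₂ _+_ (sym (∑-snoc u block)) (cong (_+ suc u C 2) (sym (nC1≡n (suc u)))) ⟩
    ∑ (suc u) block + (suc u C 1 + suc u C 2)   ≡⟨ cong (∑ (suc u) block +_) (nCk+nC[k+1]≡[n+1]C[k+1] (suc u) 1) ⟩
    ∑ (suc u) block + suc (suc u) C 2           ∎
    where
    open ≤-Reasoning
    regroup : ∀ a b c d → a + b + (c + d) ≡ c + b + (a + d)
    regroup = solve-∀

  last<n : s + suc r < n
  last<n = ≤-trans (≤-trans (m≤m+n _ (suc (s + s))) (≤-reflexive (regroup s r))) l≤n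
    where
    regroup : ∀ s r → suc (s + suc r) + suc (s + s) ≡ r + suc s * 3
    regroup = solve-∀

  open ColourTable n (E + r) c c-sym

  -- Colour ∑ u block + d sits on the star edge {u, u + 1 + d}.
  star-colour-used : ∀ col → toℕ col < E → Used col
  star-colour-used col col<E with locate block s (toℕ col) col<E
  ... | u , d , u<s , d<block , col≡ =
    colour-used col u w (<-trans u<w w<n) w<n (<⇒≢ u<w)
      (trans (c-star u w u<w u<s) (trans (cong (∑ u block +_) (suc+∸ u d)) (sym col≡)))
    where
    w : ℕ
    w = suc u + d
    u<w : u < w
    u<w = s≤s (m≤m+n u d)
    w<n : w < n
    w<n = +-<-∸ (suc u) d n d<block

  high-colour-used : ∀ col → E ≤ toℕ col → Used col
  high-colour-used col E≤col with offset-realised r (toℕ col ∸ E) r<3 offset≤r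
    where
    offset≤r : toℕ col ∸ E ≤ r
    offset≤r = ≤-trans (∸-monoˡ-≤ E (s≤s⁻¹ (toℕ<n col))) (≤-reflexive (m+n∸m≡n E r))
  ... | d , d<1+r , offset≡ =
    colour-used col (s + d) (s + suc r) (<-trans (+-monoʳ-< s d<1+r) last<n) last<n
      (λ eq → <⇒≢ d<1+r (+-cancelˡ-≡ s _ _ eq))
      (begin
        c (s + d) (s + suc r)                         ≡⟨ c-high (s + d) (s + suc r) (m≤m+n s d) (m≤m+n s (suc r)) ⟩
        E + κ (τ (s + d)) (τ (s + suc r))             ≡⟨ cong (E +_) (cong₂ κ (τ-shift d) (τ-shift (suc r))) ⟩
        E + κ (highLetter r d) (highLetter r (suc r)) ≡⟨ cong (E +_) offset≡ ⟩
        E + (toℕ col ∸ E)                             ≡⟨ m+[n∸m]≡n E≤col ⟩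
        toℕ col                                       ∎)
    where open ≡-Reasoning

  all-colours-used : UsesAllColours colouring
  all-colours-used col with toℕ col <? E
  ... | yes col<E = star-colour-used col col<E
  ... | no  col≮E = high-colour-used col (≮⇒≥ col≮E)

  bound : PrAtLeast n (r + suc s * 3) (s * n ∸ suc s C 2 + 1 + r)
  bound =
    suc (E + r) , enough-colours , colouring , all-colours-used ,
    no-proper-path star-potential τ forbidden-monochromatic (s + 2) weightless (r + suc s * 3) short
    where
    enough-colours : s * n ∸ suc s C 2 + 1 + r ≤ suc (E + r)
    enough-colours = begin
      s * n ∸ suc s C 2 + 1 + r ≡⟨ +-suc-shift (s * n ∸ suc s C 2) r ⟩
      suc (s * n ∸ suc s C 2 + r) ≤⟨ s≤s (+-monoˡ-≤ r (≤-trans (∸-monoˡ-≤ (suc s C 2) (star-edges s)) (≤-reflexive (m+n∸n≡m E (suc s C 2))))) ⟩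
      suc (E + r) ∎
      where
      open ≤-Reasoning
      +-suc-shift : ∀ a b → a + 1 + b ≡ suc (a + b)
      +-suc-shift = solve-∀
    short : ∑ (s + 2) (star-weight ∘ τ) + 2 < r + suc s * 3
    short = ≤-trans (s≤s (+-monoˡ-≤ 2 total-weight)) (≤-reflexive (regroup s r))
      where
      regroup : ∀ s r → suc (s * 3 + r + 2) ≡ r + suc s * 3
      regroup = solve-∀

PrAtLeast-⊔ : ∀ {n l m m′} → PrAtLeast n l m → PrAtLeast n l m′ → PrAtLeast n l (m ⊔ m′)
PrAtLeast-⊔ {n} {l} {m} {m′} p p′ with ≤-total m m′
... | inj₁ m≤m′ = subst (PrAtLeast n l) (sym (m≤n⇒m⊔n≡n m≤m′)) p′
... | inj₂ m′≤m = subst (PrAtLeast n l) (sym (m≥n⇒m⊔n≡m m′≤m)) p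

clique-bound : ∀ l n → 3 ≤ l → l ≤ n → PrAtLeast n l ((l ∸ 3) C 2 + 1)
clique-bound l n 3≤l l≤n =
  subst (λ L → PrAtLeast n L ((l ∸ 3) C 2 + 1)) (m∸n+n≡m 3≤l)
    (RainbowClique.bound n (l ∸ 3) (subst (_≤ n) (sym (m∸n+n≡m 3≤l)) l≤n))

star-bound : ∀ l n q r → r < 3 → l ≡ r + q * 3 → 3 ≤ l → l ≤ n →
  PrAtLeast n l ((q ∸ 1) * n ∸ q C 2 + 1 + r)
star-bound l n zero    r r<3 l≡ 3≤l l≤n =
  ⊥-elim (<⇒≱ (subst (_< 3) (sym (trans l≡ (+-identityʳ r))) r<3) 3≤l)
star-bound l n (suc s) r r<3 l≡ 3≤l l≤n =
  subst (λ L → PrAtLeast n L (s * n ∸ suc s C 2 + 1 + r)) (sym l≡)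
    (Stars.bound n s r r<3 (subst (_≤ n) l≡ l≤n))

proposition3p2 : (l n : ℕ) → 3 ≤ l → l ≤ n →
    PrAtLeast n l (((l ∸ 3) C 2 + 1) ⊔ (((l / 3 ∸ 1) * n ∸ (l / 3) C 2) + 1 + l % 3))
proposition3p2 l n 3≤l l≤n =
  PrAtLeast-⊔ (clique-bound l n 3≤l l≤n)
              (star-bound l n (l / 3) (l % 3) (m%n<n l 3) (m≡m%n+[m/n]*n l 3) 3≤l l≤n)
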